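{- Let $V$ be a finite set of cardinality $n \geq 2$, let $\alpha \in \mathbb{R}$, let $f: 2^V \to \mathbb{R}$ be a symmetric submodular function, and let $(v_1, \dots, v_n)$ be an $\alpha$-ordering of $V$ with respect to $f$. Then for every subset $X \subsetneq V$ with $|X \cap \{v_{n-1}, v_n\}| = 1$, \[ 2f(X) \geq \min_{x \in X} (1+\alpha) f(\{x\}) + (1-\alpha) f(\{v_n\}). \]
   Context: A set function $f$ on $V$ is symmetric if $f(X) = f(V\setminus X)$ for all $X \subseteq V$. For an ordering $(v_1,\dots,v_n)$ of $V$, write $V_0 := \varnothing$ and $V_i := \{v_1,\dots,v_i\}$. For $\alpha \in \mathbb{R}$, an ordering $(v_1,\dots,v_n)$ of $V$ is an $\alpha$-ordering with respect to $f$ if $f(V_{i-1}\cup\{v_i\}) + \alpha f(\{v_i\}) \leq f(V_{i-1}\cup\{v_j\}) + \alpha f(\{v_j\})$ for every pair $(i,j)$ with $1 \leq i \leq j \leq n$. -}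

module Defs where

open import Level using (Level; suc; _⊔_)
open import Data.Nat as ℕ using (ℕ)
open import Data.Fin using (Fin; toℕ)
open import Data.Fin.Subset using (Subset; _∪_; _∩_; ∁; ⁅_⁆; outside; inside)
open import Data.Fin.Permutation using (Permutation′; _⟨$⟩ʳ_; _⟨$⟩ˡ_)
open import Data.Vec using (tabulate)
open import Data.Product using (∃)
open import Relation.Nullary using (¬_; yes; no)
open import Algebra.Bundles using (CommutativeRing)
open import Relation.Binary.Structures using (IsTotalOrder)

-- Ordered fields (the paper works over ℝ; the standard library has no
-- reals, so we quantify over an arbitrary ordered field, of which ℝ is
-- an instance).

record OrderedField (c ℓ₁ ℓ₂ : Level) : Set (suc (c ⊔ ℓ₁ ⊔ ℓ₂)) where
  field
    commutativeRing : CommutativeRing c ℓ₁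
  open CommutativeRing commutativeRing public
  infix 4 _≤_
  field
    _≤_          : Carrier → Carrier → Set ℓ₂
    isTotalOrder : IsTotalOrder _≈_ _≤_
    +-mono-≤     : ∀ {x y} z → x ≤ y → x + z ≤ y + z
    *-nonneg     : ∀ {x y} → 0# ≤ x → 0# ≤ y → 0# ≤ x * y
    0≉1          : ¬ (0# ≈ 1#)
    inverse      : ∀ x → ¬ (x ≈ 0#) → ∃ λ y → x * y ≈ 1#

module _ {c ℓ₁ ℓ₂} (F : OrderedField c ℓ₁ ℓ₂) where
  open OrderedField F

  SetFunction : ℕ → Set c
  SetFunction n = Subset n → Carrier

  Symmetric : ∀ {n} → SetFunction n → Set ℓ₁
  Symmetric f = ∀ X → f X ≈ f (∁ X)

  Submodular : ∀ {n} → SetFunction n → Set ℓ₂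
  Submodular f = ∀ X Y → f (X ∪ Y) + f (X ∩ Y) ≤ f X + f Y

  -- An ordering (v_1,…,v_n) of V is a bijection σ : Fin n → Fin n,
  -- v_{i+1} = σ ⟨$⟩ʳ i (0-indexed).  prefix σ k = V_k = {v_1,…,v_k}.
  prefix : ∀ {n} → Permutation′ n → ℕ → Subset n
  prefix σ k = tabulate λ u → if< (σ ⟨$⟩ˡ u)
    where
      if< : _ → _
      if< j with toℕ j ℕ.<? k
      ... | yes _ = inside
      ... | no  _ = outside

  -- α-ordering: for 1 ≤ i ≤ j ≤ n,
  --   f(V_{i-1} ∪ {v_i}) + α f({v_i}) ≤ f(V_{i-1} ∪ {v_j}) + α f({v_j}).
  -- In 0-indexed form: i ≤ j in Fin n, V_{i-1} = prefix σ (toℕ i).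
  IsαOrdering : ∀ {n} → Carrier → SetFunction n → Permutation′ n → Set ℓ₂
  IsαOrdering α f σ =
    ∀ (i j : Fin _) → toℕ i ℕ.≤ toℕ j →
      f (prefix σ (toℕ i) ∪ ⁅ σ ⟨$⟩ʳ i ⁆) + α * f ⁅ σ ⟨$⟩ʳ i ⁆
        ≤ f (prefix σ (toℕ i) ∪ ⁅ σ ⟨$⟩ʳ j ⁆) + α * f ⁅ σ ⟨$⟩ʳ j ⁆

{-# OPTIONS --safe #-}
module Submission where

open import Defs
open import Level using (Level)
open import Data.Nat using (ℕ)
open import Data.Fin using (Fin; fromℕ; inject₁)
open import Data.Fin.Subset using (Subset; ⊤; ⁅_⁆; _∈_; _∉_)
open import Data.Fin.Permutation using (Permutation′; _⟨$⟩ʳ_)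
open import Data.Product using (Σ; _×_; ∃)
open import Data.Sum using (_⊎_)
open import Relation.Nullary using (¬_)
open import Relation.Binary.PropositionalEquality using (_≡_)

open import Data.Nat as ℕ using (zero; suc)
import Data.Nat.Properties as ℕ
open import Data.Fin as Fin using (toℕ; fromℕ<)
open import Data.Fin.Properties using (toℕ-injective; toℕ-fromℕ; toℕ-fromℕ<; toℕ≤pred[n])
open import Data.Fin.Subset using (⊥; _∪_; _∩_; ∁; _⊆_)
open import Data.Fin.Subset.Properties
  using ( _∈?_; x∈⁅x⁆; x∈⁅y⁆⇒x≡y; x∈p⇒x∉∁p; x∈∁p⇒x∉p; x∉∁p⇒x∈p; x∉p⇒x∈∁p; Empty-unique
        ; ⊆-antisym; p⊆q⇒∁p⊇∁q; p∩q⊆p; q⊆p∪q; x∈p∩q⁺; x∈p∩q⁻; x∈p∪q⁺; x∈p∪q⁻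
        ; ∪-assoc; ∪-comm; ∪-identityˡ; ∪-identityʳ; ∪-inverseˡ; ∪-distribʳ-∩
        ; ∩-comm; ∩-identityˡ; ∩-zeroˡ; ∩-distribʳ-∪ )
open import Data.Fin.Permutation using (_⟨$⟩ˡ_; inverseˡ; inverseʳ)
open import Data.Vec using (lookup)
open import Data.Vec.Properties using (lookup∘tabulate; lookup⇒[]=; []=⇒lookup)
open import Data.Maybe using (nothing)
open import Data.Product using (_,_; ∃-syntax)
open import Data.Sum using (inj₁; inj₂; [_,_])
open import Function using (_∘_; id; _∋_)
open import Relation.Nullary using (yes; no)
open import Relation.Nullary.Reflects using (Reflects; ofʸ; ofⁿ; invert; det)
open import Relation.Binary.PropositionalEquality
  using (refl; sym; trans; cong; cong₂; subst; subst₂; module ≡-Reasoning)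
open import Relation.Binary.Structures using (IsTotalOrder)
import Relation.Binary.Reasoning.Setoid as ≈-Reasoning
open import Tactic.RingSolver.Core.AlmostCommutativeRing using (fromCommutativeRing)
import Tactic.RingSolver.NonReflective as RingSolver

-- Queyranne's argument for pendent pairs, run along the α-ordering.  For a cut (S, ∁ S), a vertex
-- u ∈ S outside a set W, and a vertex x, call
--   f(W) + (1 + α) f({x}) ≤ f((W ∩ S) ∪ {u}) + f(W ∖ S) + α f({u})
-- a split bound.  Whenever v_k ∉ S (k ≥ 1), there is a split bound for W = V_k with x on either
-- prescribed side of the cut.  Passing from V_{k-1} to V_k either keeps (S, u), when v_{k-1} ∉ S,
-- at the cost of one diminishing-returns inequality, or, when v_{k-1} ∈ S, starts from the split
-- bound for (∁ S, v_k) and adds the α-ordering inequality comparing v_k with u; the empty set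
-- carries the trivial split bounds with x = u and with x = v_1.  For k = n - 1 and u = v_n we have
-- W = V ∖ {v_n}, and symmetry of f turns the split bound into the claim.

inject₁-fromℕ≡fromℕ< : ∀ m → inject₁ (fromℕ m) ≡ fromℕ< (ℕ.m<n⇒m<1+n (ℕ.n<1+n m))
inject₁-fromℕ≡fromℕ< zero    = refl
inject₁-fromℕ≡fromℕ< (suc m) = cong Fin.suc (inject₁-fromℕ≡fromℕ< m)

module _ {n : ℕ} where

  ∁-involutive : (p : Subset n) → ∁ (∁ p) ≡ p
  ∁-involutive p = ⊆-antisym (x∉∁p⇒x∈p ∘ x∈∁p⇒x∉p) (x∉p⇒x∈∁p ∘ x∈p⇒x∉∁p)

  p⊆q⇒p∩q≡p : {p q : Subset n} → p ⊆ q → p ∩ q ≡ p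
  p⊆q⇒p∩q≡p {p} {q} p⊆q = ⊆-antisym (p∩q⊆p p q) (λ x∈p → x∈p∩q⁺ (x∈p , p⊆q x∈p))

  p⊆q⇒p∪q≡q : {p q : Subset n} → p ⊆ q → p ∪ q ≡ q
  p⊆q⇒p∪q≡q {p} {q} p⊆q = ⊆-antisym ([ p⊆q , id ] ∘ x∈p∪q⁻ p q) (q⊆p∪q p q)

  p⊆q⇒[p∪r]∪q≡q∪r : {p q r : Subset n} → p ⊆ q → (p ∪ r) ∪ q ≡ q ∪ r
  p⊆q⇒[p∪r]∪q≡q∪r {p} {q} {r} p⊆q = begin
    (p ∪ r) ∪ q  ≡⟨ ∪-assoc p r q ⟩
    p ∪ (r ∪ q)  ≡⟨ cong (p ∪_) (∪-comm r q) ⟩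
    p ∪ (q ∪ r)  ≡⟨ sym (∪-assoc p q r) ⟩
    (p ∪ q) ∪ r  ≡⟨ cong (_∪ r) (p⊆q⇒p∪q≡q p⊆q) ⟩
    q ∪ r        ∎
    where open ≡-Reasoning

  x∈p⇒⁅x⁆⊆p : {x : Fin n} {p : Subset n} → x ∈ p → ⁅ x ⁆ ⊆ p
  x∈p⇒⁅x⁆⊆p {x} {p} x∈p y∈⁅x⁆ = subst (_∈ p) (sym (x∈⁅y⁆⇒x≡y x y∈⁅x⁆)) x∈p

  x∉p⇒⁅x⁆∩p≡⊥ : {x : Fin n} {p : Subset n} → x ∉ p → ⁅ x ⁆ ∩ p ≡ ⊥
  x∉p⇒⁅x⁆∩p≡⊥ {x} {p} x∉p = Empty-unique λ (y , y∈⁅x⁆∩p) →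
    let y∈⁅x⁆ , y∈p = x∈p∩q⁻ ⁅ x ⁆ p y∈⁅x⁆∩p in x∉p (subst (_∈ p) (x∈⁅y⁆⇒x≡y x y∈⁅x⁆) y∈p)

  x∉q⇒[p∪⁅x⁆]∩q≡p∩q : {p q : Subset n} {x : Fin n} → x ∉ q → (p ∪ ⁅ x ⁆) ∩ q ≡ p ∩ q
  x∉q⇒[p∪⁅x⁆]∩q≡p∩q {p} {q} {x} x∉q = begin
    (p ∪ ⁅ x ⁆) ∩ q        ≡⟨ ∩-distribʳ-∪ q p ⁅ x ⁆ ⟩
    (p ∩ q) ∪ (⁅ x ⁆ ∩ q)  ≡⟨ cong ((p ∩ q) ∪_) (x∉p⇒⁅x⁆∩p≡⊥ x∉q) ⟩
    (p ∩ q) ∪ ⊥            ≡⟨ ∪-identityʳ (p ∩ q) ⟩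
    p ∩ q                  ∎
    where open ≡-Reasoning

  x∈q⇒[p∪⁅x⁆]∩q≡[p∩q]∪⁅x⁆ : {p q : Subset n} {x : Fin n} → x ∈ q → (p ∪ ⁅ x ⁆) ∩ q ≡ (p ∩ q) ∪ ⁅ x ⁆
  x∈q⇒[p∪⁅x⁆]∩q≡[p∩q]∪⁅x⁆ {p} {q} {x} x∈q =
    trans (∩-distribʳ-∪ q p ⁅ x ⁆) (cong ((p ∩ q) ∪_) (p⊆q⇒p∩q≡p (x∈p⇒⁅x⁆⊆p x∈q)))

  x∈p⇒[∁⁅x⁆∩p]∪⁅x⁆≡p : {x : Fin n} {p : Subset n} → x ∈ p → (∁ ⁅ x ⁆ ∩ p) ∪ ⁅ x ⁆ ≡ p
  x∈p⇒[∁⁅x⁆∩p]∪⁅x⁆≡p {x} {p} x∈p = begin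
    (∁ ⁅ x ⁆ ∩ p) ∪ ⁅ x ⁆            ≡⟨ ∪-distribʳ-∩ ⁅ x ⁆ (∁ ⁅ x ⁆) p ⟩
    (∁ ⁅ x ⁆ ∪ ⁅ x ⁆) ∩ (p ∪ ⁅ x ⁆)  ≡⟨ cong₂ _∩_ (∪-inverseˡ ⁅ x ⁆) (trans (∪-comm p ⁅ x ⁆) (p⊆q⇒p∪q≡q (x∈p⇒⁅x⁆⊆p x∈p))) ⟩
    ⊤ ∩ p                            ≡⟨ ∩-identityˡ p ⟩
    p                                ∎
    where open ≡-Reasoning

  x∈p⇒∁⁅x⁆∩∁p≡∁p : {x : Fin n} {p : Subset n} → x ∈ p → ∁ ⁅ x ⁆ ∩ ∁ p ≡ ∁ p
  x∈p⇒∁⁅x⁆∩∁p≡∁p {x} {p} x∈p = trans (∩-comm (∁ ⁅ x ⁆) (∁ p)) (p⊆q⇒p∩q≡p (p⊆q⇒∁p⊇∁q (x∈p⇒⁅x⁆⊆p x∈p)))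

  Side : Subset n → Subset n → Set
  Side S Y = Y ≡ S ⊎ Y ≡ ∁ S

  side-∁ : {S Y : Subset n} → Side S Y → Side (∁ S) Y
  side-∁ {S} (inj₁ Y≡S)  = inj₂ (trans Y≡S (sym (∁-involutive S)))
  side-∁     (inj₂ Y≡∁S) = inj₁ Y≡∁S

module _ {c ℓ₁ ℓ₂ : Level} (F : OrderedField c ℓ₁ ℓ₂) where

  open OrderedField F hiding (zero) renaming (refl to ≈-refl; sym to ≈-sym; trans to ≈-trans)
  open IsTotalOrder isTotalOrder using ()
    renaming (reflexive to ≤-reflexive; trans to ≤-trans; ≲-respˡ-≈ to ≤-respˡ-≈; ≲-respʳ-≈ to ≤-respʳ-≈)
  open RingSolver (fromCommutativeRing commutativeRing (λ _ → nothing)) using (solve; _⊜_; _⊕_)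

  +-monoʳ-≤ : ∀ z {x y} → x ≤ y → z + x ≤ z + y
  +-monoʳ-≤ z {x} {y} x≤y = ≤-respˡ-≈ (+-comm x z) (≤-respʳ-≈ (+-comm y z) (+-mono-≤ z x≤y))

  +-mono-≤₂ : ∀ {x y u v} → x ≤ y → u ≤ v → x + u ≤ y + v
  +-mono-≤₂ {y = y} {u = u} x≤y u≤v = ≤-trans (+-mono-≤ u x≤y) (+-monoʳ-≤ y u≤v)

  +-cancelʳ-≤ : ∀ z {x y} → x + z ≤ y + z → x ≤ y
  +-cancelʳ-≤ z {x} {y} x+z≤y+z = ≤-respˡ-≈ (cancel x) (≤-respʳ-≈ (cancel y) (+-mono-≤ (- z) x+z≤y+z))
    where
    cancel : ∀ w → w + z + - z ≈ w
    cancel w = ≈-trans (+-assoc w z (- z)) (≈-trans (+-congˡ (-‿inverseʳ z)) (+-identityʳ w))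

  ≤-cancel-common : ∀ z {x y x′ y′} → x ≤ y → x ≈ x′ + z → y ≈ y′ + z → x′ ≤ y′
  ≤-cancel-common z x≤y x≈ y≈ = +-cancelʳ-≤ z (≤-respˡ-≈ x≈ (≤-respʳ-≈ y≈ x≤y))

  [1+x]*y≈y+x*y : ∀ x y → (1# + x) * y ≈ y + x * y
  [1+x]*y≈y+x*y x y = ≈-trans (distribʳ y 1# x) (+-congʳ (*-identityˡ y))

  [1-x]*y+x*y≈y : ∀ x y → (1# - x) * y + x * y ≈ y
  [1-x]*y+x*y≈y x y = ≈-trans (≈-sym (distribʳ y (1# - x) x)) (≈-trans (*-congʳ 1-x+x≈1) (*-identityˡ y))
    where
    1-x+x≈1 : 1# - x + x ≈ 1#
    1-x+x≈1 = ≈-trans (+-assoc 1# (- x) x) (≈-trans (+-congˡ (-‿inverseˡ x)) (+-identityʳ 1#))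

  module Prefixes {n : ℕ} (σ : Permutation′ n) where

    V : ℕ → Subset n
    V = prefix F σ

    -- v k is the paper's v_{k+1}, and V k is its V_k.
    v : (k : ℕ) → .(k ℕ.< n) → Fin n
    v k k<n = σ ⟨$⟩ʳ fromℕ< k<n

    rank : Fin n → ℕ
    rank y = toℕ (σ ⟨$⟩ˡ y)

    rank-σ : ∀ i → rank (σ ⟨$⟩ʳ i) ≡ toℕ i
    rank-σ i = cong toℕ (inverseˡ σ)

    rank-v : ∀ k .(k<n : k ℕ.< n) → rank (v k k<n) ≡ k
    rank-v k k<n = trans (rank-σ (fromℕ< k<n)) (toℕ-fromℕ< k<n)

    rank-injective : ∀ {y z} → rank y ≡ rank z → y ≡ z
    rank-injective eq = trans (sym (inverseʳ σ)) (trans (cong (σ ⟨$⟩ʳ_) (toℕ-injective eq)) (inverseʳ σ))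

    lookup-prefix-reflects : ∀ k y → Reflects (rank y ℕ.< k) (lookup (V k) y)
    lookup-prefix-reflects k y rewrite ((lookup (V k) y ≡ _) ∋ lookup∘tabulate _ y)
      with toℕ (σ ⟨$⟩ˡ y) ℕ.<? k
    ... | yes r<k = ofʸ r<k
    ... | no  r≮k = ofⁿ r≮k

    rank<⇒∈V : ∀ {k y} → rank y ℕ.< k → y ∈ V k
    rank<⇒∈V {k} {y} r<k = lookup⇒[]= y (V k) (det (lookup-prefix-reflects k y) (ofʸ r<k))

    ∈V⇒rank< : ∀ {k y} → y ∈ V k → rank y ℕ.< k
    ∈V⇒rank< {k} {y} y∈V = invert (subst (Reflects _) ([]=⇒lookup y∈V) (lookup-prefix-reflects k y))

    prefix-zero : V 0 ≡ ⊥
    prefix-zero = Empty-unique λ (_ , y∈V₀) → ℕ.n≮0 (∈V⇒rank< y∈V₀)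

    prefix-suc : ∀ k .(k<n : k ℕ.< n) → V (suc k) ≡ V k ∪ ⁅ v k k<n ⁆
    prefix-suc k k<n = ⊆-antisym forth back
      where
      forth : V (suc k) ⊆ V k ∪ ⁅ v k k<n ⁆
      forth y∈V with ℕ.m<1+n⇒m<n∨m≡n (∈V⇒rank< y∈V)
      ... | inj₁ r<k = x∈p∪q⁺ (inj₁ (rank<⇒∈V r<k))
      ... | inj₂ r≡k = x∈p∪q⁺ (inj₂ (subst (_∈ ⁅ v k k<n ⁆)
                         (sym (rank-injective (trans r≡k (sym (rank-v k k<n))))) (x∈⁅x⁆ (v k k<n))))
      back : V k ∪ ⁅ v k k<n ⁆ ⊆ V (suc k)
      back y∈ = rank<⇒∈V ([ ℕ.m<n⇒m<1+n ∘ ∈V⇒rank<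
                          , (λ y∈⁅v⁆ → ℕ.≤-reflexive (cong suc (trans (cong rank (x∈⁅y⁆⇒x≡y _ y∈⁅v⁆)) (rank-v k k<n))))
                          ] (x∈p∪q⁻ (V k) ⁅ v k k<n ⁆ y∈))

    v∉prefix : ∀ k .(k<n : k ℕ.< n) → v k k<n ∉ V k
    v∉prefix k k<n v∈V = ℕ.<-irrefl (rank-v k k<n) (∈V⇒rank< v∈V)

    ∉prefix-pred : ∀ {k u} → u ∉ V (suc k) → u ∉ V k
    ∉prefix-pred u∉V = u∉V ∘ rank<⇒∈V ∘ ℕ.m<n⇒m<1+n ∘ ∈V⇒rank<

  module _ {n : ℕ} (σ : Permutation′ (suc n)) where
    open Prefixes σ

    prefix-last : V n ≡ ∁ ⁅ σ ⟨$⟩ʳ fromℕ n ⁆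
    prefix-last = ⊆-antisym forth back
      where
      last : Fin (suc n)
      last = σ ⟨$⟩ʳ fromℕ n
      rank-last : rank last ≡ n
      rank-last = trans (rank-σ (fromℕ n)) (toℕ-fromℕ n)
      forth : V n ⊆ ∁ ⁅ last ⁆
      forth y∈V = x∉p⇒x∈∁p λ y∈⁅last⁆ →
        ℕ.<-irrefl (trans (cong rank (x∈⁅y⁆⇒x≡y last y∈⁅last⁆)) rank-last) (∈V⇒rank< y∈V)
      back : ∁ ⁅ last ⁆ ⊆ V n
      back {y} y∈∁ = rank<⇒∈V (ℕ.≤∧≢⇒< (toℕ≤pred[n] (σ ⟨$⟩ˡ y)) λ r≡n →
        x∈∁p⇒x∉p y∈∁ (subst (_∈ ⁅ last ⁆) (sym (rank-injective (trans r≡n (sym rank-last)))) (x∈⁅x⁆ last)))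

  module _ {n : ℕ} (f : SetFunction F n) where

    submodular⇒diminishing-returns : Submodular F f → ∀ {p q x} → p ⊆ q → x ∉ q →
      f (q ∪ ⁅ x ⁆) + f p ≤ f (p ∪ ⁅ x ⁆) + f q
    submodular⇒diminishing-returns submod {p} {q} {x} p⊆q x∉q =
      subst₂ (λ A B → f A + f B ≤ f (p ∪ ⁅ x ⁆) + f q)
        (p⊆q⇒[p∪r]∪q≡q∪r p⊆q) (trans (x∉q⇒[p∪⁅x⁆]∩q≡p∩q x∉q) (p⊆q⇒p∩q≡p p⊆q))
        (submod (p ∪ ⁅ x ⁆) q)

    module _ (α : Carrier) where

      SplitBound : Subset n → Subset n → Fin n → Fin n → Set ℓ₂
      SplitBound W S u x = f W + (1# + α) * f ⁅ x ⁆ ≤ f ((W ∩ S) ∪ ⁅ u ⁆) + f (W ∩ ∁ S) + α * f ⁅ u ⁆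

      SplitBoundIn : Subset n → Subset n → Subset n → Fin n → Set ℓ₂
      SplitBoundIn Y W S u = ∃[ x ] x ∈ Y × SplitBound W S u x

      splitBound⁺ : ∀ {W S u x A B} → (W ∩ S) ∪ ⁅ u ⁆ ≡ A → W ∩ ∁ S ≡ B →
        f W + (1# + α) * f ⁅ x ⁆ ≤ f A + f B + α * f ⁅ u ⁆ → SplitBound W S u x
      splitBound⁺ refl refl bound = bound

      splitBound⁻ : ∀ {W S u x A B} → (W ∩ S) ∪ ⁅ u ⁆ ≡ A → W ∩ ∁ S ≡ B →
        SplitBound W S u x → f W + (1# + α) * f ⁅ x ⁆ ≤ f A + f B + α * f ⁅ u ⁆
      splitBound⁻ refl refl bound = bound

      splitBound-⊥ : ∀ S u → SplitBound ⊥ S u u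
      splitBound-⊥ S u =
        splitBound⁺ (trans (cong (_∪ ⁅ u ⁆) (∩-zeroˡ S)) (∪-identityˡ ⁅ u ⁆)) (∩-zeroˡ (∁ S))
          (≤-reflexive (≈-trans (+-congˡ ([1+x]*y≈y+x*y α (f ⁅ u ⁆)))
            (solve 3 (λ p y ay → (p ⊕ (y ⊕ ay)) ⊜ (y ⊕ p ⊕ ay)) ≈-refl _ _ _)))

      splitBound-∪⁅⁆⁺ : ∀ {W S u x w} → w ∉ S →
        f (W ∪ ⁅ w ⁆) + (1# + α) * f ⁅ x ⁆ ≤ f ((W ∩ S) ∪ ⁅ u ⁆) + f ((W ∩ ∁ S) ∪ ⁅ w ⁆) + α * f ⁅ u ⁆ →
        SplitBound (W ∪ ⁅ w ⁆) S u x
      splitBound-∪⁅⁆⁺ {u = u} w∉S =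
        splitBound⁺ (cong (_∪ ⁅ u ⁆) (x∉q⇒[p∪⁅x⁆]∩q≡p∩q w∉S)) (x∈q⇒[p∪⁅x⁆]∩q≡[p∩q]∪⁅x⁆ (x∉p⇒x∈∁p w∉S))

      splitBound-extend : Submodular F f → ∀ {W S u x w} → w ∉ S → w ∉ W →
        SplitBound W S u x → SplitBound (W ∪ ⁅ w ⁆) S u x
      splitBound-extend submod {W} {S} {w = w} w∉S w∉W bound =
        splitBound-∪⁅⁆⁺ w∉S (≤-cancel-common (f W + f (W ∩ ∁ S)) (+-mono-≤₂ bound returns)
          (solve 4 (λ p g q b → (p ⊕ g ⊕ (q ⊕ b)) ⊜ (q ⊕ g ⊕ (p ⊕ b))) ≈-refl _ _ _ _)
          (solve 5 (λ a b c b′ p → (a ⊕ b ⊕ c ⊕ (b′ ⊕ p)) ⊜ (a ⊕ b′ ⊕ c ⊕ (p ⊕ b))) ≈-refl _ _ _ _ _))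
        where
        returns : f (W ∪ ⁅ w ⁆) + f (W ∩ ∁ S) ≤ f ((W ∩ ∁ S) ∪ ⁅ w ⁆) + f W
        returns = submodular⇒diminishing-returns submod (p∩q⊆p W (∁ S)) w∉W

      splitBound-exchange : Submodular F f → ∀ {W S u x w} → w ∉ S → u ∉ W →
        f (W ∪ ⁅ w ⁆) + α * f ⁅ w ⁆ ≤ f (W ∪ ⁅ u ⁆) + α * f ⁅ u ⁆ →
        SplitBound W (∁ S) w x → SplitBound (W ∪ ⁅ w ⁆) S u x
      splitBound-exchange submod {W} {S} {u} {x} {w} w∉S u∉W w-before-u bound =
        splitBound-∪⁅⁆⁺ w∉S (≤-cancel-common (f W + α * f ⁅ w ⁆ + f (W ∪ ⁅ u ⁆) + f (W ∩ S))
          (+-mono-≤₂ (+-mono-≤₂ bound′ w-before-u) returns)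
          (solve 6 (λ p g q d t s → (p ⊕ g ⊕ (q ⊕ d) ⊕ (t ⊕ s)) ⊜ (q ⊕ g ⊕ (p ⊕ d ⊕ t ⊕ s)))
            ≈-refl _ _ _ _ _ _)
          (solve 7 (λ b′ s d t c a p → (b′ ⊕ s ⊕ d ⊕ (t ⊕ c) ⊕ (a ⊕ p)) ⊜ (a ⊕ b′ ⊕ c ⊕ (p ⊕ d ⊕ t ⊕ s)))
            ≈-refl _ _ _ _ _ _ _))
        where
        bound′ : f W + (1# + α) * f ⁅ x ⁆ ≤ f ((W ∩ ∁ S) ∪ ⁅ w ⁆) + f (W ∩ S) + α * f ⁅ w ⁆
        bound′ = splitBound⁻ refl (cong (W ∩_) (∁-involutive S)) bound
        returns : f (W ∪ ⁅ u ⁆) + f (W ∩ S) ≤ f ((W ∩ S) ∪ ⁅ u ⁆) + f W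
        returns = submodular⇒diminishing-returns submod (p∩q⊆p W S) u∉W

      splitBound-∁⁅⁆ : Symmetric F f → ∀ {S Y u x} → u ∈ S → Side S Y → SplitBound (∁ ⁅ u ⁆) S u x →
        (1# + α) * f ⁅ x ⁆ + (1# - α) * f ⁅ u ⁆ ≤ f Y + f Y
      splitBound-∁⁅⁆ symm {S} {Y} {u} {x} u∈S side bound =
        ≤-cancel-common (α * f ⁅ u ⁆)
          (splitBound⁻ (x∈p⇒[∁⁅x⁆∩p]∪⁅x⁆≡p u∈S) (x∈p⇒∁⁅x⁆∩∁p≡∁p u∈S) bound)
          (begin
            f (∁ ⁅ u ⁆) + (1# + α) * f ⁅ x ⁆                                 ≈⟨ +-congʳ (≈-sym (symm ⁅ u ⁆)) ⟩
            f ⁅ u ⁆ + (1# + α) * f ⁅ x ⁆                                     ≈⟨ +-comm _ _ ⟩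
            (1# + α) * f ⁅ x ⁆ + f ⁅ u ⁆                                     ≈⟨ +-congˡ (≈-sym ([1-x]*y+x*y≈y α (f ⁅ u ⁆))) ⟩
            (1# + α) * f ⁅ x ⁆ + ((1# - α) * f ⁅ u ⁆ + α * f ⁅ u ⁆)          ≈⟨ ≈-sym (+-assoc _ _ _) ⟩
            (1# + α) * f ⁅ x ⁆ + (1# - α) * f ⁅ u ⁆ + α * f ⁅ u ⁆            ∎)
          (+-congʳ (sides side))
        where
        open ≈-Reasoning setoid
        sides : Side S Y → f S + f (∁ S) ≈ f Y + f Y
        sides (inj₁ refl) = +-congˡ (≈-sym (symm S))
        sides (inj₂ refl) = +-congʳ (symm S)

      module _ (σ : Permutation′ n) where
        open Prefixes σ

        α-ordering-min : IsαOrdering F α f σ → ∀ k .(k<n : k ℕ.< n) {u} → u ∉ V k →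
          f (V k ∪ ⁅ v k k<n ⁆) + α * f ⁅ v k k<n ⁆ ≤ f (V k ∪ ⁅ u ⁆) + α * f ⁅ u ⁆
        α-ordering-min isα k k<n {u} u∉V =
          subst₂ (λ j z → f (V j ∪ ⁅ v k k<n ⁆) + α * f ⁅ v k k<n ⁆ ≤ f (V j ∪ ⁅ z ⁆) + α * f ⁅ z ⁆)
            (toℕ-fromℕ< k<n) (inverseʳ σ)
            (isα (fromℕ< k<n) (σ ⟨$⟩ˡ u)
              (subst (ℕ._≤ rank u) (sym (toℕ-fromℕ< k<n)) (ℕ.≮⇒≥ (u∉V ∘ rank<⇒∈V))))

        module _ (submod : Submodular F f) (isα : IsαOrdering F α f σ) where

          splitBound-V₀ : ∀ S u → SplitBound (V 0) S u u
          splitBound-V₀ S u = subst (λ W → SplitBound W S u u) (sym prefix-zero) (splitBound-⊥ S u)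

          extend-prefix : ∀ {k} .(k<n : k ℕ.< n) {Y S u} → v k k<n ∉ S →
            SplitBoundIn Y (V k) S u → SplitBoundIn Y (V (suc k)) S u
          extend-prefix {k} k<n w∉S (x , x∈Y , bound) =
            x , x∈Y , subst (λ W → SplitBound W _ _ x) (sym (prefix-suc k k<n))
                        (splitBound-extend submod w∉S (v∉prefix k k<n) bound)

          exchange-prefix : ∀ {k} .(k<n : k ℕ.< n) {Y S u} → v k k<n ∉ S → u ∉ V (suc k) →
            SplitBoundIn Y (V k) (∁ S) (v k k<n) → SplitBoundIn Y (V (suc k)) S u
          exchange-prefix {k} k<n w∉S u∉V (x , x∈Y , bound) =
            x , x∈Y , subst (λ W → SplitBound W _ _ x) (sym (prefix-suc k k<n))
                        (splitBound-exchange submod w∉S (∉prefix-pred u∉V)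
                          (α-ordering-min isα k k<n (∉prefix-pred u∉V)) bound)

          splitBound-prefix : ∀ k .(k<n : k ℕ.< n) {S Y u} → u ∈ S → v k k<n ∉ S → u ∉ V (suc k) →
            Side S Y → SplitBoundIn Y (V (suc k)) S u
          splitBound-prefix zero k<n {S} {u = u} u∈S w∉S u∉V (inj₁ refl) =
            extend-prefix k<n w∉S (u , u∈S , splitBound-V₀ S u)
          splitBound-prefix zero k<n {S} u∈S w∉S u∉V (inj₂ refl) =
            exchange-prefix k<n w∉S u∉V (v 0 k<n , x∉p⇒x∈∁p w∉S , splitBound-V₀ (∁ S) (v 0 k<n))
          splitBound-prefix (suc j) k<n {S} u∈S w∉S u∉V side with v j (ℕ.<⇒≤ k<n) ∈? S
          ... | no  v∉S = extend-prefix k<n w∉S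
                            (splitBound-prefix j (ℕ.<⇒≤ k<n) u∈S v∉S (∉prefix-pred u∉V) side)
          ... | yes v∈S = exchange-prefix k<n w∉S u∉V
                            (splitBound-prefix j (ℕ.<⇒≤ k<n) (x∉p⇒x∈∁p w∉S) (x∈p⇒x∉∁p v∈S)
                              (v∉prefix (suc j) k<n) (side-∁ side))

  pendent-bound : ∀ {m} α (f : SetFunction F (suc (suc m))) (σ : Permutation′ (suc (suc m))) →
    Symmetric F f → Submodular F f → IsαOrdering F α f σ →
    ∀ {S Y} → σ ⟨$⟩ʳ fromℕ (suc m) ∈ S → σ ⟨$⟩ʳ inject₁ (fromℕ m) ∉ S → Side S Y →
    ∃[ x ] x ∈ Y × ((1# + α) * f ⁅ x ⁆ + (1# - α) * f ⁅ σ ⟨$⟩ʳ fromℕ (suc m) ⁆ ≤ f Y + f Y)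
  pendent-bound {m} α f σ symm submod isα {S} last∈S penultimate∉S side =
    let x , x∈Y , bound = splitBound-prefix f α σ submod isα m m<2+m last∈S v∉S last∉V side
    in x , x∈Y , splitBound-∁⁅⁆ f α symm last∈S side
                   (subst (λ W → SplitBound f α W S last x) (prefix-last σ) bound)
    where
    open Prefixes σ
    last : Fin (suc (suc m))
    last = σ ⟨$⟩ʳ fromℕ (suc m)
    m<2+m : m ℕ.< suc (suc m)
    m<2+m = ℕ.m<n⇒m<1+n (ℕ.n<1+n m)
    v∉S : v m m<2+m ∉ S
    v∉S = subst (_∉ S) (cong (σ ⟨$⟩ʳ_) (inject₁-fromℕ≡fromℕ< m)) penultimate∉S
    last∉V : last ∉ V (suc m)
    last∉V = subst (last ∉_) (sym (prefix-last σ)) (x∈p⇒x∉∁p (x∈⁅x⁆ last))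

theorem5 : ∀ {c ℓ₁ ℓ₂ : Level} (F : OrderedField c ℓ₁ ℓ₂) → let open OrderedField F in
    (m : ℕ) (α : Carrier) (f : Subset (ℕ.suc (ℕ.suc m)) → Carrier) (σ : Permutation′ (ℕ.suc (ℕ.suc m))) →
    Symmetric F f → Submodular F f → IsαOrdering F α f σ →
    (X : Subset (ℕ.suc (ℕ.suc m))) → ¬ (X ≡ ⊤) →
    ((σ ⟨$⟩ʳ inject₁ (fromℕ m) ∈ X × σ ⟨$⟩ʳ fromℕ (ℕ.suc m) ∉ X) ⊎ (σ ⟨$⟩ʳ inject₁ (fromℕ m) ∉ X × σ ⟨$⟩ʳ fromℕ (ℕ.suc m) ∈ X)) →
    Σ (Fin (ℕ.suc (ℕ.suc m))) λ x → x ∈ X × ((1# + α) * f ⁅ x ⁆ + (1# - α) * f ⁅ σ ⟨$⟩ʳ fromℕ (ℕ.suc m) ⁆ ≤ f X + f X)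
theorem5 F m α f σ symm submod isα X _ (inj₁ (penultimate∈X , last∉X)) =
  pendent-bound F α f σ symm submod isα (x∉p⇒x∈∁p last∉X) (x∈p⇒x∉∁p penultimate∈X) (inj₂ (sym (∁-involutive X)))
theorem5 F m α f σ symm submod isα X _ (inj₂ (penultimate∉X , last∈X)) =
  pendent-bound F α f σ symm submod isα last∈X penultimate∉X (inj₁ refl)
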